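{- Let $k\geq 3$ and $n> \frac{5}{2}k^3+\frac{15}{2}k^2+26k-3$ be integers, let $c(n,k):=f(n,k)+2$, and let $c:E(K^3_n)\rightarrow [c(n,k)]$ be a surjective edge-coloring of the complete 3-graph $K_n^3$ on vertex set $[n]$ such that the colored hypergraph $H$ contains no rainbow copy of $\mathcal{F}_{k+1}$. Then there exist $2k+6$ pairwise disjoint pairs $\{u_1,v_1\},\ldots,\{u_{2k+6},v_{2k+6}\}$ of vertices of $H$ such that $z_c(\{u_i,v_i\})\leq 3k$ for every $1\leq i\leq 2k+6$.
   Context: A 3-graph is a hypergraph all of whose edges have exactly 3 vertices. For a positive integer $k$, the $k$-star $\mathcal{F}_k$ is the 3-graph consisting of $k$ edges that all contain a common vertex (the core) and pairwise intersect only in the core. $f(n,k)$ denotes the maximum number of edges of a 3-graph on $n$ vertices containing no copy of $\mathcal{F}_k$. A subhypergraph of an edge-colored hypergraph is rainbow if all its edges have distinct colors. For $U\subseteq [n]$, $z_c(U)$ denotes the number of distinct colors $c(e)$ among the edges $e$ of $K_n^3$ with $U\subseteq e$. -}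

module Defs where

open import Data.Nat using (ℕ; zero; suc; _+_; _*_; _≤_)
open import Data.Fin using (Fin)
open import Data.Fin.Properties using () renaming (_≟_ to _≟ᶠ_)
open import Data.Fin.Subset using (Subset; _∈_; _⊆_; _∩_; _∪_; ⁅_⁆; ∣_∣; ⊥; inside; outside)
open import Data.Fin.Subset.Properties using (_⊆?_)
open import Data.Vec using (_∷_; []; tabulate)
open import Data.List using (List; map; _++_; length) renaming (_∷_ to _∷ₗ_; [] to []ₗ)
open import Data.List.Relation.Unary.All using (All)
open import Data.List.Relation.Unary.Any using (any?)
open import Data.List.Relation.Unary.Unique.Propositional using (Unique)
open import Data.List.Membership.Propositional using () renaming (_∈_ to _∈ₗ_)
open import Data.Product using (Σ; ∃; _×_)
open import Relation.Binary.PropositionalEquality using (_≡_; _≢_)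
open import Relation.Nullary using (¬_)
open import Relation.Nullary.Decidable using (⌊_⌋; _×-dec_)
open import Data.Nat.Properties using () renaming (_≟_ to _≟ℕ_)
open import Function.Definitions using (Injective)

IsEdge : ∀ {n} → Subset n → Set
IsEdge e = ∣ e ∣ ≡ 3

record ThreeGraph (n : ℕ) : Set where
  field
    edges  : List (Subset n)
    unique : Unique edges
    sized  : All IsEdge edges
open ThreeGraph public

numEdges : ∀ {n} → ThreeGraph n → ℕ
numEdges G = length (edges G)

IsStar : ∀ {n} (k : ℕ) → Fin n → (Fin k → Subset n) → Set
IsStar {n} k v e =
  (∀ i → IsEdge (e i)) × (∀ i → v ∈ e i) ×
  (∀ i j → i ≢ j → e i ∩ e j ≡ ⁅ v ⁆)

ContainsStar : ∀ {n} → ThreeGraph n → ℕ → Set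
ContainsStar {n} G k =
  Σ (Fin n) λ v → Σ (Fin k → Subset n) λ e → IsStar k v e × (∀ i → e i ∈ₗ edges G)

FStarFree : ∀ {n} → ThreeGraph n → ℕ → Set
FStarFree G k = ¬ ContainsStar G k

IsExtremalNumber : ℕ → ℕ → ℕ → Set
IsExtremalNumber n k m =
  (Σ (ThreeGraph n) λ G → FStarFree G k × numEdges G ≡ m) ×
  (∀ (G : ThreeGraph n) → FStarFree G k → numEdges G ≤ m)

-- An edge-colouring of K_n^3 with colour set [C] = Fin C.  Only the values on
-- 3-element subsets are relevant.
Colouring : ℕ → ℕ → Set
Colouring n C = Subset n → Fin C

Surjective : ∀ {n C} → Colouring n C → Set
Surjective {n} {C} c = ∀ (col : Fin C) → Σ (Subset n) λ e → IsEdge e × c e ≡ col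

HasRainbowStar : ∀ {n C} → Colouring n C → ℕ → Set
HasRainbowStar {n} c k =
  Σ (Fin n) λ v → Σ (Fin k → Subset n) λ e →
    IsStar k v e × Injective _≡_ _≡_ (λ i → c (e i))

allSubsets : ∀ n → List (Subset n)
allSubsets zero = [] ∷ₗ []ₗ
allSubsets (suc n) = map (outside ∷_) (allSubsets n) ++ map (inside ∷_) (allSubsets n)

coloursAt : ∀ {n C} → Colouring n C → Subset n → Subset C
coloursAt {n} c U = tabulate λ col →
  ⌊ any? (λ e → (∣ e ∣ ≟ℕ 3) ×-dec ((U ⊆? e) ×-dec (c e ≟ᶠ col))) (allSubsets n) ⌋

z : ∀ {n C} → Colouring n C → Subset n → ℕ
z c U = ∣ coloursAt c U ∣

pair : ∀ {n} → Fin n → Fin n → Subset n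
pair u v = ⁅ u ⁆ ∪ ⁅ v ⁆

-- In a set B of 2k+1 vertices other than u, if every pair {u,b} (b ∈ B) has
-- more than 3k colours, a rainbow (k+1)-star with core u is built greedily:
-- after j ≤ k petals {u,v,w}, some b ∈ B is unused (2j < 2k+1), and among the
-- more than 3k colours on edges through {u,b} one avoids the j used colours
-- and the 2j colours of the triples {u,b,x} with x a used vertex; its edge
-- {u,b,w} is a new petal, with w unused by the choice of colour.  Hence, without
-- a rainbow F_{k+1}, every such block has a pair {u,b} with at most 3k colours,
-- and n > (5/2)k³ + … leaves room for 2k+6 disjoint blocks of 2k+2 vertices.
module Submission where

open import Defs
open import Data.Bool.Properties using (T-≡)
open import Data.Empty using (⊥-elim)
open import Data.Fin using (Fin; zero; suc; combine; inject≤)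
open import Data.Fin.Properties
  using (any?; pigeonhole; <⇒≢; combine-injective; inject≤-injective; suc-injective)
  renaming (_≟_ to _≟ᶠ_)
open import Data.Fin.Subset using (Subset; _∈_; _∉_; _⊆_; _⊂_; _∩_; _∪_; ⁅_⁆; ∣_∣; ⊥; inside; outside)
open import Data.Fin.Subset.Properties
open import Data.List using (List; []; _∷_; _++_; length; lookup; map; tabulate)
open import Data.List.Membership.Propositional using () renaming (_∈_ to _∈ₗ_; _∉_ to _∉ₗ_)
open import Data.List.Membership.Propositional.Properties using (∈-++⁺ˡ; ∈-++⁺ʳ; ∈-map⁺; ∈-tabulate⁺)
import Data.List.Membership.DecPropositional as DecMembership
open import Data.List.Properties using (length-++; length-map; length-tabulate)
open import Data.List.Relation.Unary.Any using (here; there; index; satisfied)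
open import Data.List.Relation.Unary.Any.Properties using (lookup-index)
open import Data.Nat using (ℕ; zero; suc; _+_; _*_; _^_; _≤_; _<_; _≤?_; z≤n; s≤s)
open import Data.Nat.Properties
  using (≤-refl; ≤-reflexive; ≤-trans; +-identityʳ; +-comm; <-≤-trans; +-suc; +-monoʳ-≤; m≤m+n; m≤n⇒m≤1+n;
         *-monoʳ-≤; *-cancelˡ-≤; +-cancelʳ-≤; ≰⇒>; n≮n; module ≤-Reasoning)
open import Data.Nat.Tactic.RingSolver using (solve-∀)
open import Data.Product using (Σ; ∃; _×_; _,_; proj₁; proj₂)
open import Data.Sum using (_⊎_; inj₁; inj₂; [_,_]′)
open import Data.Vec using () renaming ([] to []ᵛ; _∷_ to _∷ᵛ_)
open import Data.Vec.Properties using ([]=⇒lookup; lookup∘tabulate)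
open import Function using (_∘_; case_of_)
open import Function.Bundles using (Equivalence)
open import Function.Definitions using (Injective)
open import Relation.Binary.PropositionalEquality
  using (_≡_; _≢_; refl; sym; trans; cong; cong₂; subst; module ≡-Reasoning)
open import Relation.Nullary using (¬_; yes; no; ¬?)
open import Relation.Nullary.Decidable using (toWitness; decidable-stable; _×-dec_)

private
  variable
    n m C : ℕ

∣p∪q∣≤∣p∣+∣q∣ : (p q : Subset n) → ∣ p ∪ q ∣ ≤ ∣ p ∣ + ∣ q ∣
∣p∪q∣≤∣p∣+∣q∣ []ᵛ            []ᵛ            = z≤n
∣p∪q∣≤∣p∣+∣q∣ (outside ∷ᵛ p) (outside ∷ᵛ q) = ∣p∪q∣≤∣p∣+∣q∣ p q
∣p∪q∣≤∣p∣+∣q∣ (outside ∷ᵛ p) (inside ∷ᵛ q)  =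
  ≤-trans (s≤s (∣p∪q∣≤∣p∣+∣q∣ p q)) (≤-reflexive (sym (+-suc _ _)))
∣p∪q∣≤∣p∣+∣q∣ (inside ∷ᵛ p)  (s ∷ᵛ q)       =
  s≤s (≤-trans (∣p∪q∣≤∣p∣+∣q∣ p q) (+-monoʳ-≤ _ (∣p∣≤∣x∷p∣ s q)))

fromList : List (Fin n) → Subset n
fromList []       = ⊥
fromList (x ∷ xs) = ⁅ x ⁆ ∪ fromList xs

∣fromList∣≤length : (xs : List (Fin n)) → ∣ fromList xs ∣ ≤ length xs
∣fromList∣≤length {n} []       = ≤-reflexive (∣⊥∣≡0 n)
∣fromList∣≤length (x ∷ xs) = begin
  ∣ ⁅ x ⁆ ∪ fromList xs ∣       ≤⟨ ∣p∪q∣≤∣p∣+∣q∣ ⁅ x ⁆ (fromList xs) ⟩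
  ∣ ⁅ x ⁆ ∣ + ∣ fromList xs ∣   ≡⟨ cong (_+ ∣ fromList xs ∣) (∣⁅x⁆∣≡1 x) ⟩
  suc ∣ fromList xs ∣           ≤⟨ s≤s (∣fromList∣≤length xs) ⟩
  suc (length xs)               ∎
  where open ≤-Reasoning

∈-fromList⁺ : ∀ {x : Fin n} {xs} → x ∈ₗ xs → x ∈ fromList xs
∈-fromList⁺ {x = x} (here refl) = x∈p∪q⁺ (inj₁ (x∈⁅x⁆ x))
∈-fromList⁺         (there x∈)  = x∈p∪q⁺ (inj₂ (∈-fromList⁺ x∈))

module _ {n : ℕ} where
  open DecMembership (_≟ᶠ_ {n}) using () renaming (_∈?_ to _∈ₗ?_)

  ∃∈∉ₗ : (p : Subset n) (xs : List (Fin n)) → length xs < ∣ p ∣ →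
         ∃ λ x → x ∈ p × x ∉ₗ xs
  ∃∈∉ₗ p xs xs<p with any? (λ x → (x ∈? p) ×-dec ¬? (x ∈ₗ? xs))
  ... | yes found = found
  ... | no none   = ⊥-elim (n≮n _ (<-≤-trans xs<p
        (≤-trans (p⊆q⇒∣p∣≤∣q∣ p⊆xs) (∣fromList∣≤length xs))))
    where
    p⊆xs : p ⊆ fromList xs
    p⊆xs {x} x∈p = ∈-fromList⁺ (decidable-stable (x ∈ₗ? xs) (λ x∉ → none (x , x∈p , x∉)))

  ∃-image-∉ₗ : (f : Fin m → Fin n) → Injective _≡_ _≡_ f →
               (xs : List (Fin n)) → length xs < m → ∃ λ i → f i ∉ₗ xs
  ∃-image-∉ₗ f f-inj xs xs<m with any? (λ i → ¬? (f i ∈ₗ? xs))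
  ... | yes found = found
  ... | no none =
    let i , j , i<j , same-index = pigeonhole xs<m (index ∘ f∈xs)
    in ⊥-elim (<⇒≢ i<j (f-inj (begin
      f i                        ≡⟨ lookup-index (f∈xs i) ⟩
      lookup xs (index (f∈xs i)) ≡⟨ cong (lookup xs) same-index ⟩
      lookup xs (index (f∈xs j)) ≡⟨ lookup-index (f∈xs j) ⟨
      f j                        ∎)))
    where
    open ≡-Reasoning
    f∈xs : ∀ i → f i ∈ₗ xs
    f∈xs i = decidable-stable (f i ∈ₗ? xs) (λ f∉ → none (i , f∉))

⊆-∣∣-antisym : {p q : Subset n} → p ⊆ q → ∣ q ∣ ≤ ∣ p ∣ → p ≡ q
⊆-∣∣-antisym {p = p} {q} p⊆q ∣q∣≤∣p∣ with any? (λ x → (x ∈? q) ×-dec ¬? (x ∈? p))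
... | yes (x , x∈q , x∉p) = ⊥-elim (n≮n _ (<-≤-trans (p⊂q⇒∣p∣<∣q∣ (p⊆q , x , x∈q , x∉p)) ∣q∣≤∣p∣))
... | no none = ⊆-antisym p⊆q q⊆p
  where
  q⊆p : q ⊆ p
  q⊆p {x} x∈q = decidable-stable (x ∈? p) (λ x∉p → none (x , x∈q , x∉p))

p⊂p∪q : {p q : Subset n} {x : Fin n} → x ∈ q → x ∉ p → p ⊂ p ∪ q
p⊂p∪q {q = q} {x} x∈q x∉p = p⊆p∪q q , x , x∈p∪q⁺ (inj₂ x∈q) , x∉p

∈-pairˡ : (u v : Fin n) → u ∈ pair u v
∈-pairˡ u v = x∈p∪q⁺ (inj₁ (x∈⁅x⁆ u))

∈-pairʳ : (u v : Fin n) → v ∈ pair u v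
∈-pairʳ u v = x∈p∪q⁺ (inj₂ (x∈⁅x⁆ v))

∈-pair⁻ : {x : Fin n} (u v : Fin n) → x ∈ pair u v → x ≡ u ⊎ x ≡ v
∈-pair⁻ u v x∈ with x∈p∪q⁻ ⁅ u ⁆ ⁅ v ⁆ x∈
... | inj₁ x∈u = inj₁ (x∈⁅y⁆⇒x≡y u x∈u)
... | inj₂ x∈v = inj₂ (x∈⁅y⁆⇒x≡y v x∈v)

pair-∩-⊥ : {a b a′ b′ : Fin n} → a ≢ a′ → a ≢ b′ → b ≢ a′ → b ≢ b′ →
           pair a b ∩ pair a′ b′ ≡ ⊥
pair-∩-⊥ {a = a} {b} {a′} {b′} a≢a′ a≢b′ b≢a′ b≢b′ = ⊆-antisym ∩⊆⊥ (⊥-elim ∘ ∉⊥)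
  where
  ∩⊆⊥ : pair a b ∩ pair a′ b′ ⊆ ⊥
  ∩⊆⊥ x∈ with x∈p∩q⁻ (pair a b) (pair a′ b′) x∈
  ... | x∈ab , x∈a′b′ with ∈-pair⁻ a b x∈ab | ∈-pair⁻ a′ b′ x∈a′b′
  ... | inj₁ refl | inj₁ refl = ⊥-elim (a≢a′ refl)
  ... | inj₁ refl | inj₂ refl = ⊥-elim (a≢b′ refl)
  ... | inj₂ refl | inj₁ refl = ⊥-elim (b≢a′ refl)
  ... | inj₂ refl | inj₂ refl = ⊥-elim (b≢b′ refl)

triple : Fin n → Fin n → Fin n → Subset n
triple u v w = ⁅ u ⁆ ∪ pair v w

u∈triple : (u v w : Fin n) → u ∈ triple u v w
u∈triple u v w = x∈p∪q⁺ (inj₁ (x∈⁅x⁆ u))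

∈-triple⁻ : {x : Fin n} (u v w : Fin n) → x ∈ triple u v w → x ≡ u ⊎ x ∈ pair v w
∈-triple⁻ u v w x∈ with x∈p∪q⁻ ⁅ u ⁆ (pair v w) x∈
... | inj₁ x∈u  = inj₁ (x∈⁅y⁆⇒x≡y u x∈u)
... | inj₂ x∈vw = inj₂ x∈vw

triple-∩ : {u v w v′ w′ : Fin n} → pair v w ∩ pair v′ w′ ≡ ⊥ →
           triple u v w ∩ triple u v′ w′ ≡ ⁅ u ⁆
triple-∩ {u = u} {v} {w} {v′} {w′} disjoint = begin
  (⁅ u ⁆ ∪ pair v w) ∩ (⁅ u ⁆ ∪ pair v′ w′) ≡⟨ ∪-distribˡ-∩ ⁅ u ⁆ (pair v w) (pair v′ w′) ⟨
  ⁅ u ⁆ ∪ (pair v w ∩ pair v′ w′)           ≡⟨ cong (⁅ u ⁆ ∪_) disjoint ⟩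
  ⁅ u ⁆ ∪ ⊥                                 ≡⟨ ∪-identityʳ ⁅ u ⁆ ⟩
  ⁅ u ⁆                                     ∎
  where open ≡-Reasoning

3≤∣triple∣ : {u v w : Fin n} → u ≢ v → u ≢ w → v ≢ w → 3 ≤ ∣ triple u v w ∣
3≤∣triple∣ {u = u} {v} {w} u≢v u≢w v≢w = begin-strict
  2                      ≡⟨ cong suc (∣⁅x⁆∣≡1 v) ⟨
  suc ∣ ⁅ v ⁆ ∣          ≤⟨ p⊂q⇒∣p∣<∣q∣ (p⊂p∪q (x∈⁅x⁆ w) (x≢y⇒x∉⁅y⁆ (v≢w ∘ sym))) ⟩
  ∣ pair v w ∣           <⟨ p⊂q⇒∣p∣<∣q∣ (p⊂p∪q (x∈⁅x⁆ u) u∉vw) ⟩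
  ∣ pair v w ∪ ⁅ u ⁆ ∣   ≡⟨ cong ∣_∣ (∪-comm (pair v w) ⁅ u ⁆) ⟩
  ∣ triple u v w ∣       ∎
  where
  open ≤-Reasoning
  u∉vw : u ∉ pair v w
  u∉vw u∈ = [ u≢v , u≢w ]′ (∈-pair⁻ v w u∈)

triple≡edge : {u v w : Fin n} {e : Subset n} → IsEdge e → pair u v ⊆ e → w ∈ e →
              u ≢ v → u ≢ w → v ≢ w → triple u v w ≡ e
triple≡edge {u = u} {v} {w} {e} ∣e∣≡3 uv⊆e w∈e u≢v u≢w v≢w =
  ⊆-∣∣-antisym triple⊆e (subst (_≤ ∣ triple u v w ∣) (sym ∣e∣≡3) (3≤∣triple∣ u≢v u≢w v≢w))
  where
  triple⊆e : triple u v w ⊆ e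
  triple⊆e x∈ with ∈-triple⁻ u v w x∈
  ... | inj₁ refl = uv⊆e (∈-pairˡ u v)
  ... | inj₂ x∈vw with ∈-pair⁻ v w x∈vw
  ... | inj₁ refl = uv⊆e (∈-pairʳ u v)
  ... | inj₂ refl = w∈e

∈-coloursAt⁻ : (c : Colouring n C) (U : Subset n) {col : Fin C} → col ∈ coloursAt c U →
               ∃ λ e → IsEdge e × U ⊆ e × c e ≡ col
∈-coloursAt⁻ c U {col} col∈ = satisfied (toWitness (Equivalence.from T-≡
  (trans (sym (lookup∘tabulate _ col)) ([]=⇒lookup col∈))))

∃-fresh-triple : (c : Colouring n C) {u v : Fin n} → u ≢ v →
                 (cs : List (Fin C)) → length cs < z c (pair u v) →
                 ∃ λ w → u ≢ w × v ≢ w × IsEdge (triple u v w) × c (triple u v w) ∉ₗ cs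
∃-fresh-triple c {u} {v} u≢v cs cs<z
  with col , col∈ , col∉ ← ∃∈∉ₗ (coloursAt c (pair u v)) cs cs<z
  with e , ∣e∣≡3 , uv⊆e , ce≡col ← ∈-coloursAt⁻ c (pair u v) col∈
  with w , w∈e , w∉uv ← ∃∈∉ₗ e (u ∷ v ∷ []) (subst (2 <_) (sym ∣e∣≡3) ≤-refl)
  = w , u≢w , v≢w , subst IsEdge (sym triple≡e) ∣e∣≡3 , fresh
  where
  u≢w : u ≢ w
  u≢w u≡w = w∉uv (here (sym u≡w))
  v≢w : v ≢ w
  v≢w v≡w = w∉uv (there (here (sym v≡w)))
  triple≡e : triple u v w ≡ e
  triple≡e = triple≡edge ∣e∣≡3 uv⊆e w∈e u≢v u≢w v≢w
  fresh : c (triple u v w) ∉ₗ cs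
  fresh = subst (_∉ₗ cs) (trans (sym ce≡col) (cong c (sym triple≡e))) col∉

module GreedyRainbowStar {n C : ℕ} (c : Colouring n C) (u : Fin n) (k : ℕ)
  (b : Fin (1 + 2 * k) → Fin n) (b-injective : Injective _≡_ _≡_ b) (u≢b : ∀ t → u ≢ b t)
  (rich : ∀ t → 3 * k < z c (pair u (b t))) where

  record PartialStar (j : ℕ) : Set where
    field
      v w      : Fin j → Fin n
      is-edge  : ∀ i → IsEdge (triple u (v i) (w i))
      disjoint : ∀ i i′ → i ≢ i′ → pair (v i) (w i) ∩ pair (v i′) (w i′) ≡ ⊥
      rainbow  : Injective _≡_ _≡_ (λ i → c (triple u (v i) (w i)))

    vertices : List (Fin n)
    vertices = tabulate v ++ tabulate w

    colours : List (Fin C)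
    colours = tabulate (λ i → c (triple u (v i) (w i)))

    forbidden : Fin n → List (Fin C)
    forbidden v′ = map (λ x → c (triple u v′ x)) vertices ++ colours

    length-vertices : length vertices ≡ 2 * j
    length-vertices = begin
      length (tabulate v ++ tabulate w)           ≡⟨ length-++ (tabulate v) ⟩
      length (tabulate v) + length (tabulate w)   ≡⟨ cong₂ _+_ (length-tabulate v) (length-tabulate w) ⟩
      j + j                                       ≡⟨ cong (j +_) (+-identityʳ j) ⟨
      2 * j                                       ∎
      where open ≡-Reasoning

    length-forbidden : ∀ v′ → length (forbidden v′) ≡ 3 * j
    length-forbidden v′ = begin
      length (map _ vertices ++ colours)          ≡⟨ length-++ (map _ vertices) ⟩
      length (map _ vertices) + length colours    ≡⟨ cong₂ _+_ (trans (length-map _ vertices) length-vertices)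
                                                                (length-tabulate _) ⟩
      2 * j + j                                   ≡⟨ +-comm (2 * j) j ⟩
      3 * j                                       ∎
      where open ≡-Reasoning

  open PartialStar

  empty : PartialStar 0
  empty = record { v = λ () ; w = λ () ; is-edge = λ () ; disjoint = λ () ; rainbow = λ { {()} } }

  vertices-short : ∀ {j} → j ≤ k → (S : PartialStar j) → length (vertices S) < 1 + 2 * k
  vertices-short {j} j≤k S = begin-strict
    length (vertices S)   ≡⟨ length-vertices S ⟩
    2 * j                 <⟨ s≤s (*-monoʳ-≤ 2 j≤k) ⟩
    1 + 2 * k             ∎
    where open ≤-Reasoning

  forbidden-short : ∀ {j} → j ≤ k → (S : PartialStar j) → ∀ t →
                    length (forbidden S (b t)) < z c (pair u (b t))
  forbidden-short {j} j≤k S t = begin-strict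
    length (forbidden S (b t))   ≡⟨ length-forbidden S (b t) ⟩
    3 * j                        ≤⟨ *-monoʳ-≤ 3 j≤k ⟩
    3 * k                        <⟨ rich t ⟩
    z c (pair u (b t))           ∎
    where open ≤-Reasoning

  add-petal : ∀ {j} (S : PartialStar j) {v′ w′ : Fin n} → v′ ∉ₗ vertices S →
              IsEdge (triple u v′ w′) → c (triple u v′ w′) ∉ₗ forbidden S v′ → PartialStar (suc j)
  add-petal {j} S {v′} {w′} v′∉ edge′ fresh =
    record { v = v⁺ ; w = w⁺ ; is-edge = is-edge⁺ ; disjoint = disjoint⁺ ; rainbow = rainbow⁺ }
    where
    avoid : ∀ {x y} {xs : List (Fin n)} → x ∉ₗ xs → y ∈ₗ xs → x ≢ y
    avoid x∉ y∈ refl = x∉ y∈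

    v-used : ∀ i → v S i ∈ₗ vertices S
    v-used i = ∈-++⁺ˡ (∈-tabulate⁺ i)

    w-used : ∀ i → w S i ∈ₗ vertices S
    w-used i = ∈-++⁺ʳ (tabulate (v S)) (∈-tabulate⁺ i)

    w′∉ : w′ ∉ₗ vertices S
    w′∉ w′∈ = fresh (∈-++⁺ˡ (∈-map⁺ (λ x → c (triple u v′ x)) w′∈))

    new-colour-unused : c (triple u v′ w′) ∉ₗ colours S
    new-colour-unused used = fresh (∈-++⁺ʳ (map _ (vertices S)) used)

    v⁺ w⁺ : Fin (suc j) → Fin n
    v⁺ zero    = v′
    v⁺ (suc i) = v S i
    w⁺ zero    = w′
    w⁺ (suc i) = w S i

    is-edge⁺ : ∀ i → IsEdge (triple u (v⁺ i) (w⁺ i))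
    is-edge⁺ zero    = edge′
    is-edge⁺ (suc i) = is-edge S i

    new-disjoint : ∀ i → pair v′ w′ ∩ pair (v S i) (w S i) ≡ ⊥
    new-disjoint i = pair-∩-⊥ (avoid v′∉ (v-used i)) (avoid v′∉ (w-used i))
                              (avoid w′∉ (v-used i)) (avoid w′∉ (w-used i))

    disjoint⁺ : ∀ i i′ → i ≢ i′ → pair (v⁺ i) (w⁺ i) ∩ pair (v⁺ i′) (w⁺ i′) ≡ ⊥
    disjoint⁺ zero    zero     i≢i′ = ⊥-elim (i≢i′ refl)
    disjoint⁺ zero    (suc i′) _    = new-disjoint i′
    disjoint⁺ (suc i) zero     _    = trans (∩-comm _ _) (new-disjoint i)
    disjoint⁺ (suc i) (suc i′) i≢i′ = disjoint S i i′ (i≢i′ ∘ cong suc)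

    rainbow⁺ : Injective _≡_ _≡_ (λ i → c (triple u (v⁺ i) (w⁺ i)))
    rainbow⁺ {zero}  {zero}   _  = refl
    rainbow⁺ {zero}  {suc i′} eq = ⊥-elim (new-colour-unused (subst (_∈ₗ colours S) (sym eq) (∈-tabulate⁺ i′)))
    rainbow⁺ {suc i} {zero}   eq = ⊥-elim (new-colour-unused (subst (_∈ₗ colours S) eq (∈-tabulate⁺ i)))
    rainbow⁺ {suc i} {suc i′} eq = cong suc (rainbow S eq)

  extend : ∀ {j} → j ≤ k → PartialStar j → PartialStar (suc j)
  extend j≤k S =
    let t , v′∉ = ∃-image-∉ₗ b b-injective (vertices S) (vertices-short j≤k S)
        _ , _ , _ , edge′ , fresh = ∃-fresh-triple c (u≢b t) (forbidden S (b t)) (forbidden-short j≤k S t)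
    in add-petal S v′∉ edge′ fresh

  partialStar : ∀ j → j ≤ suc k → PartialStar j
  partialStar zero    _         = empty
  partialStar (suc j) (s≤s j≤k) = extend j≤k (partialStar j (m≤n⇒m≤1+n j≤k))

  rainbowStar : PartialStar (suc k) → HasRainbowStar c (suc k)
  rainbowStar S = u , (λ i → triple u (v S i) (w S i)) ,
    (is-edge S , (λ i → u∈triple u (v S i) (w S i)) , (λ i i′ i≢i′ → triple-∩ (disjoint S i i′ i≢i′))) ,
    rainbow S

∃-sparse-pair : (c : Colouring n C) (k : ℕ) (u : Fin n) (b : Fin (1 + 2 * k) → Fin n) →
                Injective _≡_ _≡_ b → (∀ t → u ≢ b t) → ¬ HasRainbowStar c (suc k) →
                ∃ λ t → z c (pair u (b t)) ≤ 3 * k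
∃-sparse-pair c k u b b-injective u≢b no-rainbow with any? (λ t → z c (pair u (b t)) ≤? 3 * k)
... | yes sparse = sparse
... | no  none   = ⊥-elim (no-rainbow (rainbowStar (partialStar (suc k) ≤-refl)))
  where
  open GreedyRainbowStar c u k b b-injective u≢b (λ t → ≰⇒> (λ sparse → none (t , sparse)))

block : ∀ {p q} → p * q ≤ n → Fin p → Fin q → Fin n
block pq≤n i s = inject≤ (combine i s) pq≤n

block-injective : ∀ {p q} (pq≤n : p * q ≤ n) {i j : Fin p} {s t : Fin q} →
                  block pq≤n i s ≡ block pq≤n j t → i ≡ j × s ≡ t
block-injective pq≤n {i} {j} {s} {t} eq =
  combine-injective i s j t (inject≤-injective pq≤n pq≤n _ _ eq)

-- Powers are written out (k ^ 3 unfolds to k * (k * (k * 1))): the ring solver rejects _^_ here.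
private
  blocks-fit-surplus : ∀ m →
    1 + (5 * ((1 + m) * ((1 + m) * ((1 + m) * 1))) + 15 * ((1 + m) * ((1 + m) * 1)) + 52 * (1 + m)) ≡
    2 * ((2 * (1 + m) + 6) * (2 + 2 * (1 + m))) + 6 + (5 * (m * m * m) + 22 * (m * m) + 49 * m + 3)
  blocks-fit-surplus = solve-∀

blocks-fit : ∀ k n → 1 ≤ k → 5 * k ^ 3 + 15 * k ^ 2 + 52 * k < 2 * n + 6 →
             (2 * k + 6) * (2 + 2 * k) ≤ n
blocks-fit (suc m) n _ bound = *-cancelˡ-≤ 2 (+-cancelʳ-≤ 6 _ _ (begin
  2 * ((2 * suc m + 6) * (2 + 2 * suc m)) + 6
    ≤⟨ m≤m+n _ _ ⟩
  2 * ((2 * suc m + 6) * (2 + 2 * suc m)) + 6 + (5 * (m * m * m) + 22 * (m * m) + 49 * m + 3)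
    ≡⟨ blocks-fit-surplus m ⟨
  suc (5 * suc m ^ 3 + 15 * suc m ^ 2 + 52 * suc m)
    ≤⟨ bound ⟩
  2 * n + 6
    ∎))
  where open ≤-Reasoning

lemma3 : (k n m : ℕ) → 3 ≤ k →
         5 * k ^ 3 + 15 * k ^ 2 + 52 * k < 2 * n + 6 →
         IsExtremalNumber n k m →
         (c : Colouring n (m + 2)) → Surjective c →
         ¬ HasRainbowStar c (suc k) →
         Σ (Fin (2 * k + 6) → Fin n) λ u → Σ (Fin (2 * k + 6) → Fin n) λ v →
           (∀ i → u i ≢ v i) ×
           (∀ i j → i ≢ j → pair (u i) (v i) ∩ pair (u j) (v j) ≡ ⊥) ×
           (∀ i → z c (pair (u i) (v i)) ≤ 3 * k)
lemma3 k n m 3≤k bound _ c _ no-rainbow = u , v , u≢v , disjoint , sparse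
  where
  fits : (2 * k + 6) * (2 + 2 * k) ≤ n
  fits = blocks-fit k n (≤-trans (s≤s z≤n) 3≤k) bound

  vertex : Fin (2 * k + 6) → Fin (2 + 2 * k) → Fin n
  vertex = block fits

  vertex-injective : ∀ {i j s t} → vertex i s ≡ vertex j t → i ≡ j × s ≡ t
  vertex-injective = block-injective fits

  sparse-pair : ∀ i → ∃ λ t → z c (pair (vertex i zero) (vertex i (suc t))) ≤ 3 * k
  sparse-pair i = ∃-sparse-pair c k (vertex i zero) (vertex i ∘ suc)
    (suc-injective ∘ proj₂ ∘ vertex-injective)
    (λ t eq → case proj₂ (vertex-injective eq) of λ ())
    no-rainbow

  u v : Fin (2 * k + 6) → Fin n
  u i = vertex i zero
  v i = vertex i (suc (proj₁ (sparse-pair i)))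

  u≢v : ∀ i → u i ≢ v i
  u≢v i eq = case proj₂ (vertex-injective eq) of λ ()

  apart : ∀ {i j s t} → i ≢ j → vertex i s ≢ vertex j t
  apart i≢j = i≢j ∘ proj₁ ∘ vertex-injective

  disjoint : ∀ i j → i ≢ j → pair (u i) (v i) ∩ pair (u j) (v j) ≡ ⊥
  disjoint i j i≢j = pair-∩-⊥ (apart i≢j) (apart i≢j) (apart i≢j) (apart i≢j)

  sparse : ∀ i → z c (pair (u i) (v i)) ≤ 3 * k
  sparse i = proj₂ (sparse-pair i)
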